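{- Let $G$ be an antimatroid on a finite ground set $S$ with $|S|=n$, and let $T(G;x,y)=\sum_{i,j}b_{i,j}x^iy^j$ be its Tutte polynomial. For $i,j\ge 0$ let $a_{i,j}$ be the number of convex sets $C$ of $G$ with $|C|=i$ and $|\mathrm{int}(C)|=j$. Then for all $i,j$, $$b_{i,j}=\sum_{s=i}^n(-1)^{s-i}\binom{s}{i}a_{s,j}.$$
   Context: An antimatroid on a finite set $S$ is a family $\mathcal{F}$ of subsets of $S$ (the feasible sets) such that $\emptyset\in\mathcal{F}$, $S\in\mathcal{F}$, $\mathcal{F}$ is closed under unions, and every nonempty $F\in\mathcal{F}$ contains some $x$ with $F-x\in\mathcal{F}$. Its rank function is $r(A)=\max\{|F|:F\in\mathcal{F},F\subseteq A\}$ (so $r(S)=|S|$), and its Tutte polynomial is $T(G;x,y)=\sum_{A\subseteq S}(x-1)^{r(S)-r(A)}(y-1)^{|A|-r(A)}$. A set $C\subseteq S$ is convex if $S-C\in\mathcal{F}$. The convex closure $\overline{A}$ of $A\subseteq S$ is the smallest convex set containing $A$ (the intersection of all convex sets containing $A$). For convex $C$, a point $p\in C$ is extreme if $p\notin\overline{C-p}$; $\mathrm{ex}(C)$ is the set of extreme points and $\mathrm{int}(C)=C-\mathrm{ex}(C)$ is the interior of $C$. -}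

module Defs where

open import Data.Bool using (Bool; true; false; _∧_; not; if_then_else_)
open import Data.Nat as ℕ using (ℕ; zero; suc; _∸_; _⊔_)
open import Data.Integer as ℤ using (ℤ; 0ℤ; 1ℤ; -1ℤ; +_)
open import Data.Fin using (Fin)
open import Data.Fin.Subset using (Subset; ⊥; ⊤; _∪_; _∩_; _─_; _-_; _∈_; _∉_; _⊆_; ∁; ∣_∣; Nonempty; inside; outside)
open import Data.Fin.Subset.Properties using (_⊆?_)
open import Data.Vec using (Vec; []; _∷_; tabulate; lookup)
open import Data.List as List using (List; []; _∷_; _++_; map; foldr; filterᵇ; upTo; applyUpTo)
open import Data.Product using (Σ; _×_; _,_)
open import Relation.Nullary using (does)
open import Relation.Binary.PropositionalEquality using (_≡_)

record Antimatroid (n : ℕ) : Set where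
  field
    feasible   : Subset n → Bool
    empty-feas : feasible ⊥ ≡ true
    full-feas  : feasible ⊤ ≡ true
    union-feas : ∀ A B → feasible A ≡ true → feasible B ≡ true → feasible (A ∪ B) ≡ true
    accessible : ∀ F → feasible F ≡ true → Nonempty F →
                 Σ (Fin n) (λ x → x ∈ F × feasible (F - x) ≡ true)

open Antimatroid public

allSubsets : (n : ℕ) → List (Subset n)
allSubsets zero    = [] ∷ []
allSubsets (suc n) = map (outside ∷_) (allSubsets n) ++ map (inside ∷_) (allSubsets n)

module _ {n : ℕ} (G : Antimatroid n) where

  rank : Subset n → ℕ
  rank A = foldr _⊔_ 0
             (map ∣_∣ (filterᵇ (λ F → feasible G F ∧ does (F ⊆? A)) (allSubsets n)))

  convex : Subset n → Bool
  convex C = feasible G (∁ C)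

  closure : Subset n → Subset n
  closure A = foldr _∩_ ⊤ (filterᵇ (λ C → convex C ∧ does (A ⊆? C)) (allSubsets n))

  ex : Subset n → Subset n
  ex C = tabulate (λ p → lookup C p ∧ not (lookup (closure (C - p)) p))

  int : Subset n → Subset n
  int C = C ─ ex C

  aCount : ℕ → ℕ → ℕ
  aCount i j = List.length
    (filterᵇ (λ C → convex C ∧ (does (∣ C ∣ ℕ.≟ i) ∧ does (∣ int C ∣ ℕ.≟ j))) (allSubsets n))

-- Bivariate polynomials over ℤ, represented by their coefficient function:
-- p i j = coefficient of x^i y^j.

Poly : Set
Poly = ℕ → ℕ → ℤ

sumℤ : List ℤ → ℤ
sumℤ = foldr ℤ._+_ 0ℤ

range0 : ℕ → List ℕ
range0 k = upTo (suc k)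

constP : ℤ → Poly
constP c zero zero = c
constP c _    _    = 0ℤ

X : Poly
X (suc zero) zero = 1ℤ
X _          _    = 0ℤ

Y : Poly
Y zero (suc zero) = 1ℤ
Y _    _          = 0ℤ

_+P_ : Poly → Poly → Poly
(p +P q) i j = p i j ℤ.+ q i j

-P_ : Poly → Poly
(-P p) i j = ℤ.- (p i j)

_*P_ : Poly → Poly → Poly
(p *P q) i j =
  sumℤ (map (λ a → sumℤ (map (λ b → p a b ℤ.* q (i ∸ a) (j ∸ b)) (range0 j))) (range0 i))

_^P_ : Poly → ℕ → Poly
p ^P zero  = constP 1ℤ
p ^P suc k = p *P (p ^P k)

sumP : List Poly → Poly
sumP = foldr _+P_ (constP 0ℤ)

tutte : {n : ℕ} → Antimatroid n → Poly
tutte {n} G = sumP (map term (allSubsets n))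
  where
  term : Subset n → Poly
  term A = ((X +P constP -1ℤ) ^P (rank G ⊤ ∸ rank G A))
        *P ((Y +P constP -1ℤ) ^P (∣ A ∣ ∸ rank G A))

-- [i .. n] (empty if i > n)
interval : ℕ → ℕ → List ℕ
interval i n = map (i ℕ.+_) (upTo (suc n ∸ i))

-- For A ⊆ S the feasible subsets of A are closed under union, so A has a largest feasible
-- subset B(A), and r(A) = |B(A)|.  A point p of a convex set K is extreme iff ∁ K ∪ {p} is
-- feasible; together with the augmentation property this shows that ∁ K = B(A) exactly when
-- ∁ K ⊆ A ⊆ ∁ K ∪ int K.  These Boolean intervals therefore partition the power set, and on
-- the interval of K the Tutte summand is (x-1)^|K| (y-1)^(|A| - |∁ K|), which sums to
-- (x-1)^|K| y^|int K|.  Reading off the coefficient of x^i y^j gives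
-- Σ_K (-1)^(|K|-i) (|K| choose i) [|int K| = j], the alternating sum of the a_{s,j}.

module Submission where

open import Defs
open import Data.Bool using (Bool; true; false; T; _∧_; not; if_then_else_)
open import Data.Bool.Properties using (not-involutive; ∨-identityʳ; ∨-zeroʳ; ∧-zeroʳ; ∧-identityʳ)
open import Data.Fin as Fin using (Fin; zero; suc)
open import Data.Fin.Subset
  using (Subset; ⊤; ⊥; _∪_; _∩_; _─_; _-_; _∈_; _∉_; _⊆_; ∁; ∣_∣; ⁅_⁆; Empty; ⋃; inside; outside)
open import Data.Fin.Subset.Properties
  using ( _⊆?_; _∈?_; nonempty?; ⊆-refl; ⊆-antisym; ⊥⊆; ⊆⊤; ∈⊤; ∣⊤∣≡n; ∣p∣≤n; ∣∁p∣≡n∸∣p∣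
        ; p⊆q⇒∣p∣≤∣q∣; x∈p⇒∣p-x∣<∣p∣; p⊆p∪q; q⊆p∪q; x∈p∪q⁺; x∈p∪q⁻; x∈p∩q⁺; x∈p∩q⁻
        ; x∉p⇒x∈∁p; x∉∁p⇒x∈p; x∈∁p⇒x∉p; p⊆q⇒∁p⊇∁q; p─q⊆p; x∈p∧x∉q⇒x∈p─q; x∈p∧x≢y⇒x∈p-y
        ; x∈⁅x⁆; x∈⁅y⁆⇒x≡y; drop-∷-Empty )
open import Data.Integer using (ℤ; 0ℤ; 1ℤ; -1ℤ; +_; _+_; _*_; _^_; -_)
import Data.Integer.Properties as ℤ
open import Data.Integer.Tactic.RingSolver using (solve-∀)
open import Data.List using (List; []; _∷_; _++_; map; foldr; upTo; filterᵇ; length)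
open import Data.List.Membership.Propositional using (lose) renaming (_∈_ to _∈ᴸ_)
open import Data.List.Membership.Propositional.Properties using (∈-map⁺; ∈-++⁺ˡ; ∈-++⁺ʳ; ∈-filter⁺)
open import Data.List.Properties using (map-upTo; foldr-preservesᵇ; foldr-preservesᵒ; foldr-forcesᵇ)
open import Data.List.Relation.Unary.All as All using (All)
open import Data.List.Relation.Unary.All.Properties using (all-filter; map⁺)
import Data.List.Relation.Unary.Any as Any
open import Data.Nat as ℕ using (ℕ; zero; suc; _∸_; _≤_; _<_; _⊔_; z≤n; s≤s)
import Data.Nat.Properties as ℕ
open import Data.Nat.Combinatorics using (_C_; nCk+nC[k+1]≡[n+1]C[k+1]; nCn≡1; k>n⇒nCk≡0)
open import Data.Nat.Induction using (<-wellFounded)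
open import Data.Product using (_×_; _,_; proj₁; proj₂; ∃-syntax)
open import Data.Sum using (_⊎_; inj₁; inj₂; [_,_])
open import Data.Vec using (_∷_; []; lookup; here; there)
open import Data.Vec.Properties using (∷-injectiveʳ; []=⇒lookup; lookup⇒[]=; lookup∘tabulate)
open import Function using (_∘_; _⇔_; mk⇔; Equivalence)
open import Induction.WellFounded using (Acc; acc)
open import Relation.Binary.Definitions using (tri<; tri≈; tri>)
open import Relation.Binary.PropositionalEquality
  using (_≡_; _≢_; refl; sym; trans; cong; cong₂; subst; module ≡-Reasoning)
open import Relation.Nullary using (Dec; yes; no; does; ¬_; contradiction; _×-dec_)
open import Relation.Nullary.Decidable using (T?)

open Equivalence

private
  variable
    A B P : Set
    n : ℕ

-- Finite sums

∑ : List A → (A → ℤ) → ℤ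
∑ xs f = sumℤ (map f xs)

infix 5 ∑
syntax ∑ xs (λ x → e) = ∑[ x ← xs ] e

∑-++ : ∀ (xs ys : List A) f → ∑ (xs ++ ys) f ≡ ∑ xs f + ∑ ys f
∑-++ []       ys f = sym (ℤ.+-identityˡ _)
∑-++ (x ∷ xs) ys f = trans (cong (_+_ (f x)) (∑-++ xs ys f)) (sym (ℤ.+-assoc (f x) _ _))

∑-map : ∀ (g : A → B) xs f → ∑ (map g xs) f ≡ ∑ xs (f ∘ g)
∑-map g []       f = refl
∑-map g (x ∷ xs) f = cong (_+_ (f (g x))) (∑-map g xs f)

∑-cong : ∀ (xs : List A) {f g} → (∀ x → f x ≡ g x) → ∑ xs f ≡ ∑ xs g
∑-cong []       f≗g = refl
∑-cong (x ∷ xs) f≗g = cong₂ _+_ (f≗g x) (∑-cong xs f≗g)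

∑-zero : ∀ (xs : List A) {f} → (∀ x → f x ≡ 0ℤ) → ∑ xs f ≡ 0ℤ
∑-zero []       f≗0 = refl
∑-zero (x ∷ xs) f≗0 = cong₂ _+_ (f≗0 x) (∑-zero xs f≗0)

∑-+ : ∀ (xs : List A) f g → ∑[ x ← xs ] (f x + g x) ≡ ∑ xs f + ∑ xs g
∑-+ []       f g = refl
∑-+ (x ∷ xs) f g =
  trans (cong (_+_ (f x + g x)) (∑-+ xs f g)) (interchange (f x) (g x) (∑ xs f) (∑ xs g))
  where
  interchange : ∀ a b c d → a + b + (c + d) ≡ a + c + (b + d)
  interchange = solve-∀

*-∑ : ∀ c (xs : List A) f → c * ∑ xs f ≡ ∑[ x ← xs ] c * f x
*-∑ c []       f = ℤ.*-zeroʳ c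
*-∑ c (x ∷ xs) f = trans (ℤ.*-distribˡ-+ c (f x) _) (cong (_+_ (c * f x)) (*-∑ c xs f))

∑-comm : ∀ (xs : List A) (ys : List B) (h : A → B → ℤ) →
         ∑[ x ← xs ] ∑[ y ← ys ] h x y ≡ ∑[ y ← ys ] ∑[ x ← xs ] h x y
∑-comm []       ys h = sym (∑-zero ys (λ _ → refl))
∑-comm (x ∷ xs) ys h =
  trans (cong (_+_ (∑ ys (h x))) (∑-comm xs ys h)) (sym (∑-+ ys (h x) _))

length-filterᵇ : ∀ (p : A → Bool) xs →
                 + length (filterᵇ p xs) ≡ ∑[ x ← xs ] (if p x then 1ℤ else 0ℤ)
length-filterᵇ p []       = refl
length-filterᵇ p (x ∷ xs) with p x
... | true  = trans (ℤ.pos-+ 1 _) (cong (_+_ 1ℤ) (length-filterᵇ p xs))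
... | false = trans (length-filterᵇ p xs) (sym (ℤ.+-identityˡ _))

∑-upTo-suc : ∀ m (g : ℕ → ℤ) → ∑ (upTo (suc m)) g ≡ g 0 + ∑ (upTo m) (g ∘ suc)
∑-upTo-suc m g =
  cong (_+_ (g 0)) (trans (cong (λ xs → ∑ xs g) (sym (map-upTo suc m))) (∑-map suc (upTo m) g))

∑-upTo-zero : ∀ m (g : ℕ → ℤ) → (∀ k → k < m → g k ≡ 0ℤ) → ∑ (upTo m) g ≡ 0ℤ
∑-upTo-zero zero    g g≗0 = refl
∑-upTo-zero (suc m) g g≗0 = trans (∑-upTo-suc m g)
  (cong₂ _+_ (g≗0 0 (s≤s z≤n)) (∑-upTo-zero m (g ∘ suc) (λ k k<m → g≗0 (suc k) (s≤s k<m))))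

∑-upTo-single : ∀ {m c} (g : ℕ → ℤ) → c < m → (∀ k → k < m → k ≢ c → g k ≡ 0ℤ) →
                ∑ (upTo m) g ≡ g c
∑-upTo-single {suc m} {zero} g _ g≗0 = begin
  ∑ (upTo (suc m)) g
    ≡⟨ ∑-upTo-suc m g ⟩
  g 0 + ∑ (upTo m) (g ∘ suc)
    ≡⟨ cong (_+_ (g 0)) (∑-upTo-zero m (g ∘ suc) λ k k<m → g≗0 (suc k) (s≤s k<m) λ ()) ⟩
  g 0 + 0ℤ
    ≡⟨ ℤ.+-identityʳ (g 0) ⟩
  g 0 ∎
  where open ≡-Reasoning
∑-upTo-single {suc m} {suc c} g (s≤s c<m) g≗0 = begin
  ∑ (upTo (suc m)) g
    ≡⟨ ∑-upTo-suc m g ⟩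
  g 0 + ∑ (upTo m) (g ∘ suc)
    ≡⟨ cong₂ _+_ (g≗0 0 (s≤s z≤n) λ ()) (∑-upTo-single (g ∘ suc) c<m g∘suc≗0) ⟩
  0ℤ + g (suc c)
    ≡⟨ ℤ.+-identityˡ (g (suc c)) ⟩
  g (suc c) ∎
  where
  open ≡-Reasoning
  g∘suc≗0 : ∀ k → k < m → k ≢ c → g (suc k) ≡ 0ℤ
  g∘suc≗0 k k<m k≢c = g≗0 (suc k) (s≤s k<m) (k≢c ∘ ℕ.suc-injective)

∑-upTo-head : ∀ m (g : ℕ → ℤ) → (∀ k → g (suc k) ≡ 0ℤ) → ∑ (upTo (suc m)) g ≡ g 0
∑-upTo-head m g g≗0 = ∑-upTo-single g (s≤s z≤n) vanishes
  where
  vanishes : ∀ k → k < suc m → k ≢ 0 → g k ≡ 0ℤ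
  vanishes zero    _ 0≢0 = contradiction refl 0≢0
  vanishes (suc k) _ _   = g≗0 k

T-does : (d : Dec P) → T (does d) ⇔ P
T-does (yes p) = mk⇔ (λ _ → p) (λ _ → _)
T-does (no ¬p) = mk⇔ (λ ()) ¬p

T-∧-does : ∀ {b : Bool} (d : Dec P) → T (b ∧ does d) ⇔ (b ≡ true × P)
T-∧-does {b = true}  d = mk⇔ (λ t → refl , T-does d .to t) (λ (_ , p) → T-does d .from p)
T-∧-does {b = false} d = mk⇔ (λ ()) (λ ())

if-yes : (d : Dec P) {x : ℤ} → P → (if does d then x else 0ℤ) ≡ x
if-yes (yes _) _ = refl
if-yes (no ¬p) p = contradiction p ¬p

if-no : (d : Dec P) {x : ℤ} → ¬ P → (if does d then x else 0ℤ) ≡ 0ℤ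
if-no (yes p) ¬p = contradiction p ¬p
if-no (no _)  _  = refl

*-if : ∀ b c x → (if b then c * x else 0ℤ) ≡ c * (if b then x else 0ℤ)
*-if true  c x = refl
*-if false c x = sym (ℤ.*-zeroʳ c)

∑-interval-single : ∀ (g : ℕ → ℤ) {c} i n → c ≤ n → (c < i → g c ≡ 0ℤ) →
  ∑[ s ← interval i n ] (if does (c ℕ.≟ s) then g s else 0ℤ) ≡ g c
∑-interval-single g {c} i n c≤n g≡0 =
  trans (∑-map (i ℕ.+_) (upTo (suc n ∸ i)) f) (by-cases (i ℕ.≤? c))
  where
  f : ℕ → ℤ
  f s = if does (c ℕ.≟ s) then g s else 0ℤ
  by-cases : Dec (i ≤ c) → ∑ (upTo (suc n ∸ i)) (f ∘ (i ℕ.+_)) ≡ g c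
  by-cases (yes i≤c) = begin
    ∑ (upTo (suc n ∸ i)) (f ∘ (i ℕ.+_))
      ≡⟨ ∑-upTo-single (f ∘ (i ℕ.+_)) (ℕ.∸-monoˡ-< (s≤s c≤n) i≤c) off-c ⟩
    f (i ℕ.+ (c ∸ i))
      ≡⟨ cong f (ℕ.m+[n∸m]≡n i≤c) ⟩
    f c
      ≡⟨ if-yes (c ℕ.≟ c) refl ⟩
    g c ∎
    where
    open ≡-Reasoning
    off-c : ∀ k → k < suc n ∸ i → k ≢ c ∸ i → f (i ℕ.+ k) ≡ 0ℤ
    off-c k _ k≢c∸i = if-no (c ℕ.≟ i ℕ.+ k) λ c≡i+k →
      k≢c∸i (sym (trans (cong (_∸ i) c≡i+k) (ℕ.m+n∸m≡n i k)))
  by-cases (no i≰c) = trans (∑-zero (upTo (suc n ∸ i)) below) (sym (g≡0 c<i))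
    where
    c<i : c < i
    c<i = ℕ.≰⇒> i≰c
    below : ∀ k → f (i ℕ.+ k) ≡ 0ℤ
    below k = if-no (c ℕ.≟ i ℕ.+ k) (ℕ.<⇒≢ (ℕ.<-≤-trans c<i (ℕ.m≤m+n i k)))

-- Signed binomial coefficients

signedBinom : ℕ → ℕ → ℤ
signedBinom s i = (-1ℤ ^ (s ∸ i)) * (+ (s C i))

signedBinom-< : ∀ {s i} → s < i → signedBinom s i ≡ 0ℤ
signedBinom-< {s} {i} s<i =
  trans (cong (λ c → (-1ℤ ^ (s ∸ i)) * (+ c)) (k>n⇒nCk≡0 s<i)) (ℤ.*-zeroʳ (-1ℤ ^ (s ∸ i)))

signedBinom-diag : ∀ s → signedBinom s s ≡ 1ℤ
signedBinom-diag s = cong₂ (λ e c → (-1ℤ ^ e) * (+ c)) (ℕ.n∸n≡0 s) (nCn≡1 s)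

signedBinom-suc-zero : ∀ s → signedBinom (suc s) 0 ≡ - signedBinom s 0
signedBinom-suc-zero s = negate-scaled (-1ℤ ^ s) (+ 1)
  where
  negate-scaled : ∀ x c → (-1ℤ * x) * c ≡ - (x * c)
  negate-scaled = solve-∀

signedBinom-pascal : ∀ s i → signedBinom (suc s) (suc i) ≡ - signedBinom s (suc i) + signedBinom s i
signedBinom-pascal s i with ℕ.<-cmp i s
... | tri< i<s _ _ = begin
  (-1ℤ ^ (s ∸ i)) * (+ (suc s C suc i))
    ≡⟨ cong₂ (λ e c → (-1ℤ ^ e) * c) s∸i≡ pascal ⟩
  (-1ℤ * x) * ((+ (s C i)) + (+ (s C suc i)))
    ≡⟨ distribute x (+ (s C i)) (+ (s C suc i)) ⟩
  - (x * (+ (s C suc i))) + (-1ℤ * x) * (+ (s C i))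
    ≡⟨ cong (λ e → - (x * (+ (s C suc i))) + (-1ℤ ^ e) * (+ (s C i))) (sym s∸i≡) ⟩
  - signedBinom s (suc i) + signedBinom s i ∎
  where
  open ≡-Reasoning
  x : ℤ
  x = -1ℤ ^ (s ∸ suc i)
  s∸i≡ : s ∸ i ≡ suc (s ∸ suc i)
  s∸i≡ = ℕ.+-∸-assoc 1 i<s
  pascal : + (suc s C suc i) ≡ (+ (s C i)) + (+ (s C suc i))
  pascal = trans (cong +_ (sym (nCk+nC[k+1]≡[n+1]C[k+1] s i))) (ℤ.pos-+ (s C i) (s C suc i))
  distribute : ∀ x a b → (-1ℤ * x) * (a + b) ≡ - (x * b) + (-1ℤ * x) * a
  distribute = solve-∀
... | tri≈ _ refl _ = trans (signedBinom-diag (suc i))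
  (sym (cong₂ (λ u v → - u + v) (signedBinom-< (ℕ.n<1+n i)) (signedBinom-diag i)))
... | tri> _ _ s<i = trans (signedBinom-< (s≤s s<i))
  (sym (cong₂ (λ u v → - u + v) (signedBinom-< (ℕ.m<n⇒m<1+n s<i)) (signedBinom-< s<i)))

δ : ℕ → ℕ → ℤ
δ m j = if does (m ℕ.≟ j) then 1ℤ else 0ℤ

-- binomialSum m φ = Σ_k (m choose k) · φ k, unfolded along Pascal's rule.
binomialSum : ℕ → (ℕ → ℤ) → ℤ
binomialSum zero    φ = φ 0
binomialSum (suc m) φ = binomialSum m φ + binomialSum m (φ ∘ suc)

binomialSum-cong : ∀ m {φ ψ : ℕ → ℤ} → (∀ k → φ k ≡ ψ k) →
                   binomialSum m φ ≡ binomialSum m ψ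
binomialSum-cong zero    φ≗ψ = φ≗ψ 0
binomialSum-cong (suc m) φ≗ψ = cong₂ _+_ (binomialSum-cong m φ≗ψ) (binomialSum-cong m (φ≗ψ ∘ suc))

binomialSum-neg : ∀ m (φ : ℕ → ℤ) → binomialSum m (-_ ∘ φ) ≡ - binomialSum m φ
binomialSum-neg zero    φ = refl
binomialSum-neg (suc m) φ = trans (cong₂ _+_ (binomialSum-neg m φ) (binomialSum-neg m (φ ∘ suc)))
                                  (sym (ℤ.neg-distrib-+ (binomialSum m φ) _))

binomialSum-+ : ∀ m (φ ψ : ℕ → ℤ) →
                binomialSum m (λ k → φ k + ψ k) ≡ binomialSum m φ + binomialSum m ψ
binomialSum-+ zero    φ ψ = refl
binomialSum-+ (suc m) φ ψ =
  trans (cong₂ _+_ (binomialSum-+ m φ ψ) (binomialSum-+ m (φ ∘ suc) (ψ ∘ suc)))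
        (interchange (binomialSum m φ) (binomialSum m ψ) _ _)
  where
  interchange : ∀ a b c d → a + b + (c + d) ≡ a + c + (b + d)
  interchange = solve-∀

binomialSum-signedBinom : ∀ m j → binomialSum m (λ k → signedBinom k j) ≡ δ m j
binomialSum-signedBinom zero    zero    = refl
binomialSum-signedBinom zero    (suc j) = refl
binomialSum-signedBinom (suc m) zero    = begin
  binomialSum m φ + binomialSum m (φ ∘ suc)
    ≡⟨ cong (_+_ (binomialSum m φ)) (binomialSum-cong m signedBinom-suc-zero) ⟩
  binomialSum m φ + binomialSum m (-_ ∘ φ)
    ≡⟨ cong (_+_ (binomialSum m φ)) (binomialSum-neg m φ) ⟩
  binomialSum m φ + - binomialSum m φ
    ≡⟨ ℤ.+-inverseʳ (binomialSum m φ) ⟩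
  0ℤ ∎
  where
  open ≡-Reasoning
  φ : ℕ → ℤ
  φ k = signedBinom k 0
binomialSum-signedBinom (suc m) (suc j) = begin
  binomialSum m φ + binomialSum m (φ ∘ suc)
    ≡⟨ cong (_+_ (binomialSum m φ)) (binomialSum-cong m (λ k → signedBinom-pascal k j)) ⟩
  binomialSum m φ + binomialSum m (λ k → - φ k + ψ k)
    ≡⟨ cong (_+_ (binomialSum m φ)) (binomialSum-+ m (-_ ∘ φ) ψ) ⟩
  binomialSum m φ + (binomialSum m (-_ ∘ φ) + binomialSum m ψ)
    ≡⟨ cong (λ t → binomialSum m φ + (t + binomialSum m ψ)) (binomialSum-neg m φ) ⟩
  binomialSum m φ + (- binomialSum m φ + binomialSum m ψ)
    ≡⟨ cancel (binomialSum m φ) (binomialSum m ψ) ⟩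
  binomialSum m ψ
    ≡⟨ binomialSum-signedBinom m j ⟩
  δ m j ∎
  where
  open ≡-Reasoning
  φ ψ : ℕ → ℤ
  φ k = signedBinom k (suc j)
  ψ k = signedBinom k j
  cancel : ∀ a b → a + (- a + b) ≡ b
  cancel = solve-∀

-- Coefficients of the Tutte polynomial

InX : Poly → Set
InX p = ∀ a b → p a (suc b) ≡ 0ℤ

InY : Poly → Set
InY p = ∀ a b → p (suc a) b ≡ 0ℤ

x-1 : Poly
x-1 = X +P constP -1ℤ

y-1 : Poly
y-1 = Y +P constP -1ℤ

shiftˣ : Poly → Poly
shiftˣ R zero    j = 0ℤ
shiftˣ R (suc i) j = R i j

shiftʸ : Poly → Poly
shiftʸ R i zero    = 0ℤ
shiftʸ R i (suc j) = R i j

constP-0 : ∀ i j → constP 0ℤ i j ≡ 0ℤ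
constP-0 zero    zero    = refl
constP-0 zero    (suc j) = refl
constP-0 (suc i) j       = refl

x-1-inX : InX x-1
x-1-inX zero          b = refl
x-1-inX (suc zero)    b = refl
x-1-inX (suc (suc a)) b = refl

y-1-inY : InY y-1
y-1-inY a       zero          = refl
y-1-inY zero    (suc zero)    = refl
y-1-inY (suc a) (suc zero)    = refl
y-1-inY a       (suc (suc b)) = refl

*P-inXˡ : ∀ p R → InX p → ∀ i j → (p *P R) i j ≡ ∑[ a ← upTo (suc i) ] p a 0 * R (i ∸ a) j
*P-inXˡ p R p-inX i j = ∑-cong (upTo (suc i)) λ a →
  ∑-upTo-head j (λ b → p a b * R (i ∸ a) (j ∸ b)) λ b →
    trans (cong (_* R (i ∸ a) (j ∸ suc b)) (p-inX a b)) (ℤ.*-zeroˡ (R (i ∸ a) (j ∸ suc b)))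

*P-inYˡ : ∀ p R → InY p → ∀ i j → (p *P R) i j ≡ ∑[ b ← upTo (suc j) ] p 0 b * R i (j ∸ b)
*P-inYˡ p R p-inY i j =
  ∑-upTo-head i (λ a → ∑[ b ← upTo (suc j) ] p a b * R (i ∸ a) (j ∸ b)) λ a →
    ∑-zero (upTo (suc j)) λ b →
      trans (cong (_* R (i ∸ suc a) (j ∸ b)) (p-inY a b)) (ℤ.*-zeroˡ (R (i ∸ suc a) (j ∸ b)))

x-1-*P : ∀ R i j → (x-1 *P R) i j ≡ - R i j + shiftˣ R i j
x-1-*P R i j = begin
  (x-1 *P R) i j
    ≡⟨ *P-inXˡ x-1 R x-1-inX i j ⟩
  ∑[ a ← upTo (suc i) ] x-1 a 0 * R (i ∸ a) j
    ≡⟨ ∑-upTo-suc i (λ a → x-1 a 0 * R (i ∸ a) j) ⟩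
  -1ℤ * R i j + (∑[ a ← upTo i ] x-1 (suc a) 0 * R (i ∸ suc a) j)
    ≡⟨ cong₂ _+_ (ℤ.-1*i≡-i (R i j)) (shift i) ⟩
  - R i j + shiftˣ R i j ∎
  where
  open ≡-Reasoning
  shift : ∀ i → ∑[ a ← upTo i ] x-1 (suc a) 0 * R (i ∸ suc a) j ≡ shiftˣ R i j
  shift zero     = refl
  shift (suc i′) = trans
    (∑-upTo-head i′ (λ a → x-1 (suc a) 0 * R (i′ ∸ a) j) (λ a → ℤ.*-zeroˡ (R (i′ ∸ suc a) j)))
    (ℤ.*-identityˡ (R i′ j))

y-1-*P : ∀ R i j → (y-1 *P R) i j ≡ - R i j + shiftʸ R i j
y-1-*P R i j = begin
  (y-1 *P R) i j
    ≡⟨ *P-inYˡ y-1 R y-1-inY i j ⟩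
  ∑[ b ← upTo (suc j) ] y-1 0 b * R i (j ∸ b)
    ≡⟨ ∑-upTo-suc j (λ b → y-1 0 b * R i (j ∸ b)) ⟩
  -1ℤ * R i j + (∑[ b ← upTo j ] y-1 0 (suc b) * R i (j ∸ suc b))
    ≡⟨ cong₂ _+_ (ℤ.-1*i≡-i (R i j)) (shift j) ⟩
  - R i j + shiftʸ R i j ∎
  where
  open ≡-Reasoning
  shift : ∀ j → ∑[ b ← upTo j ] y-1 0 (suc b) * R i (j ∸ suc b) ≡ shiftʸ R i j
  shift zero     = refl
  shift (suc j′) = trans
    (∑-upTo-head j′ (λ b → y-1 0 (suc b) * R i (j′ ∸ b)) (λ b → ℤ.*-zeroˡ (R i (j′ ∸ suc b))))
    (ℤ.*-identityˡ (R i j′))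

x-1^-coeff : ∀ a i → (x-1 ^P a) i 0 ≡ signedBinom a i
x-1^-coeff zero    zero    = refl
x-1^-coeff zero    (suc i) = refl
x-1^-coeff (suc a) zero    = trans (x-1-*P (x-1 ^P a) 0 0)
  (trans (ℤ.+-identityʳ _) (trans (cong -_ (x-1^-coeff a 0)) (sym (signedBinom-suc-zero a))))
x-1^-coeff (suc a) (suc i) = trans (x-1-*P (x-1 ^P a) (suc i) 0)
  (trans (cong₂ (λ u v → - u + v) (x-1^-coeff a (suc i)) (x-1^-coeff a i)) (sym (signedBinom-pascal a i)))

x-1^-inX : ∀ a → InX (x-1 ^P a)
x-1^-inX zero    zero    j = refl
x-1^-inX zero    (suc i) j = refl
x-1^-inX (suc a) zero    j = trans (x-1-*P (x-1 ^P a) 0 (suc j))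
  (cong (λ u → - u + 0ℤ) (x-1^-inX a 0 j))
x-1^-inX (suc a) (suc i) j = trans (x-1-*P (x-1 ^P a) (suc i) (suc j))
  (cong₂ (λ u v → - u + v) (x-1^-inX a (suc i) j) (x-1^-inX a i j))

y-1^-coeff : ∀ b j → (y-1 ^P b) 0 j ≡ signedBinom b j
y-1^-coeff zero    zero    = refl
y-1^-coeff zero    (suc j) = refl
y-1^-coeff (suc b) zero    = trans (y-1-*P (y-1 ^P b) 0 0)
  (trans (ℤ.+-identityʳ _) (trans (cong -_ (y-1^-coeff b 0)) (sym (signedBinom-suc-zero b))))
y-1^-coeff (suc b) (suc j) = trans (y-1-*P (y-1 ^P b) 0 (suc j))
  (trans (cong₂ (λ u v → - u + v) (y-1^-coeff b (suc j)) (y-1^-coeff b j)) (sym (signedBinom-pascal b j)))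

y-1^-inY : ∀ b → InY (y-1 ^P b)
y-1^-inY zero    i zero    = refl
y-1^-inY zero    i (suc j) = refl
y-1^-inY (suc b) i zero    = trans (y-1-*P (y-1 ^P b) (suc i) 0)
  (cong (λ u → - u + 0ℤ) (y-1^-inY b i 0))
y-1^-inY (suc b) i (suc j) = trans (y-1-*P (y-1 ^P b) (suc i) (suc j))
  (cong₂ (λ u v → - u + v) (y-1^-inY b i (suc j)) (y-1^-inY b i j))

*P-separable : ∀ p q → InX p → InY q → ∀ i j → (p *P q) i j ≡ p i 0 * q 0 j
*P-separable p q p-inX q-inY i j = begin
  (p *P q) i j
    ≡⟨ *P-inXˡ p q p-inX i j ⟩
  ∑[ a ← upTo (suc i) ] p a 0 * q (i ∸ a) j
    ≡⟨ ∑-upTo-single (λ a → p a 0 * q (i ∸ a) j) (ℕ.n<1+n i) off-diagonal ⟩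
  p i 0 * q (i ∸ i) j
    ≡⟨ cong (λ k → p i 0 * q k j) (ℕ.n∸n≡0 i) ⟩
  p i 0 * q 0 j ∎
  where
  open ≡-Reasoning
  off-diagonal : ∀ k → k < suc i → k ≢ i → p k 0 * q (i ∸ k) j ≡ 0ℤ
  off-diagonal k k≤i k≢i = begin
    p k 0 * q (i ∸ k) j
      ≡⟨ cong (λ e → p k 0 * q e j) (ℕ.+-∸-assoc 1 (ℕ.≤∧≢⇒< (ℕ.≤-pred k≤i) k≢i)) ⟩
    p k 0 * q (suc (i ∸ suc k)) j
      ≡⟨ cong (p k 0 *_) (q-inY _ j) ⟩
    p k 0 * 0ℤ
      ≡⟨ ℤ.*-zeroʳ (p k 0) ⟩
    0ℤ ∎

sumP-coeff : ∀ (t : A → Poly) xs i j → sumP (map t xs) i j ≡ ∑[ x ← xs ] t x i j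
sumP-coeff t []       i j = constP-0 i j
sumP-coeff t (x ∷ xs) i j = cong (_+_ (t x i j)) (sumP-coeff t xs i j)

tutte-coeff : ∀ {n} (G : Antimatroid n) i j → tutte G i j ≡
  ∑[ A ← allSubsets n ] signedBinom (rank G ⊤ ∸ rank G A) i * signedBinom (∣ A ∣ ∸ rank G A) j
tutte-coeff {n} G i j = trans (sumP-coeff _ (allSubsets n) i j) (∑-cong (allSubsets n) λ A →
  let a = rank G ⊤ ∸ rank G A
      b = ∣ A ∣ ∸ rank G A
  in trans (*P-separable (x-1 ^P a) (y-1 ^P b) (x-1^-inX a) (y-1^-inY b) i j)
           (cong₂ _*_ (x-1^-coeff a i) (y-1^-coeff b j)))

-- Subsets

∁-involutive : ∀ (p : Subset n) → ∁ (∁ p) ≡ p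
∁-involutive []      = refl
∁-involutive (s ∷ p) = cong₂ _∷_ (not-involutive s) (∁-involutive p)

∁-─ : ∀ (p q : Subset n) → ∁ (p ─ q) ≡ ∁ p ∪ q
∁-─ []      []            = refl
∁-─ (s ∷ p) (outside ∷ q) = cong₂ _∷_ (sym (∨-identityʳ (not s))) (∁-─ p q)
∁-─ (s ∷ p) (inside  ∷ q) = cong₂ _∷_ (sym (∨-zeroʳ (not s))) (∁-─ p q)

x∈p─q⇒x∉q : ∀ {x : Fin n} (p q : Subset n) → x ∈ p ─ q → x ∉ q
x∈p─q⇒x∉q (inside ∷ p) (outside ∷ q) here          ()
x∈p─q⇒x∉q (_ ∷ p)      (_ ∷ q)       (there x∈p─q) (there x∈q) = x∈p─q⇒x∉q p q x∈p─q x∈q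

x∉p-x : ∀ (p : Subset n) x → x ∉ p - x
x∉p-x p x x∈p-x = x∈p─q⇒x∉q p ⁅ x ⁆ x∈p-x (x∈⁅x⁆ x)

⁅x⁆⊆p : ∀ {x : Fin n} {p} → x ∈ p → ⁅ x ⁆ ⊆ p
⁅x⁆⊆p {x = x} {p} x∈p y∈⁅x⁆ = subst (_∈ p) (sym (x∈⁅y⁆⇒x≡y x y∈⁅x⁆)) x∈p

∪-lub : ∀ {p q r : Subset n} → p ⊆ r → q ⊆ r → p ∪ q ⊆ r
∪-lub {p = p} {q} p⊆r q⊆r x∈p∪q = [ p⊆r , q⊆r ] (x∈p∪q⁻ p q x∈p∪q)

p∪q≡p∪r : ∀ {p q r : Subset n} → q ⊆ p ∪ r → r ⊆ p ∪ q → p ∪ q ≡ p ∪ r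
p∪q≡p∪r {p = p} {q} {r} q⊆p∪r r⊆p∪q =
  ⊆-antisym (∪-lub (p⊆p∪q r) q⊆p∪r) (∪-lub (p⊆p∪q q) r⊆p∪q)

p-x⊆q⇒p⊆q∪⁅x⁆ : ∀ {p q : Subset n} {x} → p - x ⊆ q → p ⊆ q ∪ ⁅ x ⁆
p-x⊆q⇒p⊆q∪⁅x⁆ {x = x} p-x⊆q {y} y∈p with y Fin.≟ x
... | yes refl = x∈p∪q⁺ (inj₂ (x∈⁅x⁆ x))
... | no  y≢x  = x∈p∪q⁺ (inj₁ (p-x⊆q (x∈p∧x≢y⇒x∈p-y y∈p y≢x)))

∁p∩[p─q]-empty : ∀ (p q : Subset n) → Empty (∁ p ∩ (p ─ q))
∁p∩[p─q]-empty p q (x , x∈) with x∈p∩q⁻ (∁ p) (p ─ q) x∈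
... | x∈∁p , x∈p─q = x∈∁p⇒x∉p x∈∁p (p─q⊆p p q x∈p─q)

∈-allSubsets : ∀ (A : Subset n) → A ∈ᴸ allSubsets n
∈-allSubsets []            = Any.here refl
∈-allSubsets (outside ∷ A) = ∈-++⁺ˡ (∈-map⁺ (outside ∷_) (∈-allSubsets A))
∈-allSubsets {suc n} (inside ∷ A) =
  ∈-++⁺ʳ (map (outside ∷_) (allSubsets n)) (∈-map⁺ (inside ∷_) (∈-allSubsets A))

∑-allSubsets-suc : ∀ n (g : Subset (suc n) → ℤ) → ∑ (allSubsets (suc n)) g ≡
                   ∑ (allSubsets n) (g ∘ (outside ∷_)) + ∑ (allSubsets n) (g ∘ (inside ∷_))
∑-allSubsets-suc n g = trans (∑-++ (map (outside ∷_) (allSubsets n)) _ g)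
  (cong₂ _+_ (∑-map (outside ∷_) (allSubsets n) g) (∑-map (inside ∷_) (allSubsets n) g))

∑-allSubsets-single : ∀ (g : Subset n → ℤ) K → (∀ L → L ≢ K → g L ≡ 0ℤ) →
                      ∑ (allSubsets n) g ≡ g K
∑-allSubsets-single g [] _ = ℤ.+-identityʳ (g [])
∑-allSubsets-single {suc n} g (outside ∷ K) g≗0 = begin
  ∑ (allSubsets (suc n)) g
    ≡⟨ ∑-allSubsets-suc n g ⟩
  ∑ (allSubsets n) (g ∘ (outside ∷_)) + ∑ (allSubsets n) (g ∘ (inside ∷_))
    ≡⟨ cong₂ _+_ (∑-allSubsets-single (g ∘ (outside ∷_)) K λ L L≢K → g≗0 _ (L≢K ∘ ∷-injectiveʳ))
                 (∑-zero (allSubsets n) λ L → g≗0 _ λ ()) ⟩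
  g (outside ∷ K) + 0ℤ
    ≡⟨ ℤ.+-identityʳ _ ⟩
  g (outside ∷ K) ∎
  where open ≡-Reasoning
∑-allSubsets-single {suc n} g (inside ∷ K) g≗0 = begin
  ∑ (allSubsets (suc n)) g
    ≡⟨ ∑-allSubsets-suc n g ⟩
  ∑ (allSubsets n) (g ∘ (outside ∷_)) + ∑ (allSubsets n) (g ∘ (inside ∷_))
    ≡⟨ cong₂ _+_ (∑-zero (allSubsets n) λ L → g≗0 _ λ ())
                 (∑-allSubsets-single (g ∘ (inside ∷_)) K λ L L≢K → g≗0 _ (L≢K ∘ ∷-injectiveʳ)) ⟩
  0ℤ + g (inside ∷ K)
    ≡⟨ ℤ.+-identityˡ _ ⟩
  g (inside ∷ K) ∎
  where open ≡-Reasoning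

intervalSum : Subset n → Subset n → (ℕ → ℤ) → ℤ
intervalSum {n} F M φ =
  ∑[ A ← allSubsets n ] (if does (F ⊆? A) ∧ does (A ⊆? F ∪ M) then φ (∣ A ∣ ∸ ∣ F ∣) else 0ℤ)

intervalSum-binomialSum : ∀ (F M : Subset n) → Empty (F ∩ M) → ∀ φ →
                          intervalSum F M φ ≡ binomialSum ∣ M ∣ φ
intervalSum-binomialSum []  [] _ φ = ℤ.+-identityʳ (φ 0)
intervalSum-binomialSum {suc n} (outside ∷ F) (outside ∷ M) disjoint φ = begin
  intervalSum (outside ∷ F) (outside ∷ M) φ
    ≡⟨ ∑-allSubsets-suc n _ ⟩
  intervalSum F M φ + (∑[ A ← allSubsets n ] (if does (F ⊆? A) ∧ false then ψ A else 0ℤ))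
    ≡⟨ cong₂ _+_ (intervalSum-binomialSum F M (drop-∷-Empty disjoint) φ)
                 (∑-zero (allSubsets n) λ A → cong (λ b → if b then ψ A else 0ℤ) (∧-zeroʳ (does (F ⊆? A)))) ⟩
  binomialSum (∣ M ∣) φ + 0ℤ
    ≡⟨ ℤ.+-identityʳ _ ⟩
  binomialSum (∣ M ∣) φ ∎
  where
  open ≡-Reasoning
  ψ : Subset n → ℤ
  ψ A = φ (suc ∣ A ∣ ∸ ∣ F ∣)
intervalSum-binomialSum {suc n} (outside ∷ F) (inside ∷ M) disjoint φ = begin
  intervalSum (outside ∷ F) (inside ∷ M) φ
    ≡⟨ ∑-allSubsets-suc n _ ⟩
  intervalSum F M φ + (∑[ A ← allSubsets n ] (if between A then φ (suc ∣ A ∣ ∸ ∣ F ∣) else 0ℤ))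
    ≡⟨ cong (_+_ (intervalSum F M φ)) (∑-cong (allSubsets n) new-element) ⟩
  intervalSum F M φ + intervalSum F M (φ ∘ suc)
    ≡⟨ cong₂ _+_ (intervalSum-binomialSum F M (drop-∷-Empty disjoint) φ)
                 (intervalSum-binomialSum F M (drop-∷-Empty disjoint) (φ ∘ suc)) ⟩
  binomialSum (suc ∣ M ∣) φ ∎
  where
  open ≡-Reasoning
  between : Subset n → Bool
  between A = does (F ⊆? A) ∧ does (A ⊆? F ∪ M)
  new-element : ∀ A → (if between A then φ (suc ∣ A ∣ ∸ ∣ F ∣) else 0ℤ)
                    ≡ (if between A then φ (suc (∣ A ∣ ∸ ∣ F ∣)) else 0ℤ)
  new-element A with F ⊆? A
  ... | yes F⊆A = cong (λ k → if does (A ⊆? F ∪ M) then φ k else 0ℤ)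
                       (ℕ.+-∸-assoc 1 (p⊆q⇒∣p∣≤∣q∣ F⊆A))
  ... | no  _   = refl
intervalSum-binomialSum {suc n} (inside ∷ F) (outside ∷ M) disjoint φ = begin
  intervalSum (inside ∷ F) (outside ∷ M) φ
    ≡⟨ ∑-allSubsets-suc n _ ⟩
  ∑ (allSubsets n) (λ _ → 0ℤ) + intervalSum F M φ
    ≡⟨ cong₂ _+_ (∑-zero (allSubsets n) λ _ → refl)
                 (intervalSum-binomialSum F M (drop-∷-Empty disjoint) φ) ⟩
  0ℤ + binomialSum (∣ M ∣) φ
    ≡⟨ ℤ.+-identityˡ _ ⟩
  binomialSum (∣ M ∣) φ ∎
  where open ≡-Reasoning
intervalSum-binomialSum (inside ∷ F) (inside ∷ M) disjoint φ = contradiction (zero , here) disjoint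

-- Antimatroids

foldr-⊔-≤ : ∀ {b} {xs : List ℕ} → All (_≤ b) xs → foldr _⊔_ 0 xs ≤ b
foldr-⊔-≤ = foldr-preservesᵇ ℕ.⊔-lub z≤n

≤-foldr-⊔ : ∀ {x} {xs : List ℕ} → x ∈ᴸ xs → x ≤ foldr _⊔_ 0 xs
≤-foldr-⊔ {x} {xs} x∈xs = foldr-preservesᵒ ⊔-preserves 0 xs (inj₂ (lose x∈xs ℕ.≤-refl))
  where
  ⊔-preserves : ∀ a b → x ≤ a ⊎ x ≤ b → x ≤ a ⊔ b
  ⊔-preserves a b = [ (λ x≤a → ℕ.≤-trans x≤a (ℕ.m≤m⊔n a b)) , (λ x≤b → ℕ.≤-trans x≤b (ℕ.m≤n⊔m a b)) ]

module _ {n : ℕ} (G : Antimatroid n) where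

  Feasible : Subset n → Set
  Feasible F = feasible G F ≡ true

  Convex : Subset n → Set
  Convex K = convex G K ≡ true

  -- Walk down an accessible chain H, H - x, …; once H - x ⊆ F, the point x augments F,
  -- because F ∪ ⁅ x ⁆ = F ∪ H.
  augment : ∀ {F H} → Feasible F → Feasible H →
            H ⊆ F ⊎ ∃[ p ] (p ∈ H × p ∉ F × Feasible (F ∪ ⁅ p ⁆))
  augment {F} {H} fF fH = go H (<-wellFounded ∣ H ∣) fH
    where
    go : ∀ H → Acc _<_ ∣ H ∣ → Feasible H →
         H ⊆ F ⊎ ∃[ p ] (p ∈ H × p ∉ F × Feasible (F ∪ ⁅ p ⁆))
    go H (acc smaller) fH with nonempty? H
    ... | no H-empty = inj₁ (λ x∈H → contradiction (_ , x∈H) H-empty)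
    ... | yes H-nonempty with accessible G H fH H-nonempty
    ... | x , x∈H , fH-x with go (H - x) (smaller (x∈p⇒∣p-x∣<∣p∣ x∈H)) fH-x
    ...   | inj₂ (p , p∈H-x , p-augments) = inj₂ (p , p─q⊆p H ⁅ x ⁆ p∈H-x , p-augments)
    ...   | inj₁ H-x⊆F with x ∈? F
    ...     | yes x∈F = inj₁ (∪-lub ⊆-refl (⁅x⁆⊆p x∈F) ∘ p-x⊆q⇒p⊆q∪⁅x⁆ H-x⊆F)
    ...     | no  x∉F = inj₂ (x , x∈H , x∉F , subst Feasible F∪H≡F∪⁅x⁆ (union-feas G F H fF fH))
      where
      F∪H≡F∪⁅x⁆ : F ∪ H ≡ F ∪ ⁅ x ⁆
      F∪H≡F∪⁅x⁆ = p∪q≡p∪r (p-x⊆q⇒p⊆q∪⁅x⁆ H-x⊆F) (q⊆p∪q F H ∘ ⁅x⁆⊆p x∈H)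

  feasibleSubsets : Subset n → List (Subset n)
  feasibleSubsets A = filterᵇ (λ F → feasible G F ∧ does (F ⊆? A)) (allSubsets n)

  ∈-feasibleSubsets⁺ : ∀ {F A} → Feasible F → F ⊆ A → F ∈ᴸ feasibleSubsets A
  ∈-feasibleSubsets⁺ {F} {A} fF F⊆A =
    ∈-filter⁺ (T? ∘ _) (∈-allSubsets F) (T-∧-does (F ⊆? A) .from (fF , F⊆A))

  all-feasibleSubsets : ∀ A → All (λ F → Feasible F × F ⊆ A) (feasibleSubsets A)
  all-feasibleSubsets A = All.map (T-∧-does (_ ⊆? A) .to) (all-filter (T? ∘ _) (allSubsets n))

  record IsBasis (F A : Subset n) : Set where
    field
      basis-feasible : Feasible F
      basis-⊆        : F ⊆ A
      basis-largest  : ∀ {H} → Feasible H → H ⊆ A → H ⊆ F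

  open IsBasis

  basis : Subset n → Subset n
  basis A = ⋃ (feasibleSubsets A)

  basis-isBasis : ∀ A → IsBasis (basis A) A
  basis-isBasis A = record
    { basis-feasible = foldr-preservesᵇ (union-feas G _ _) (empty-feas G) (All.map proj₁ members)
    ; basis-⊆        = foldr-preservesᵇ ∪-lub ⊥⊆ (All.map proj₂ members)
    ; basis-largest  = λ fH H⊆A x∈H → foldr-preservesᵒ (λ _ _ → x∈p∪q⁺) ⊥ (feasibleSubsets A)
                                        (inj₂ (lose (∈-feasibleSubsets⁺ fH H⊆A) x∈H))
    }
    where members = all-feasibleSubsets A

  isBasis-unique : ∀ {F A} → IsBasis F A → F ≡ basis A
  isBasis-unique {F} {A} b = ⊆-antisym
    (basis-largest (basis-isBasis A) (basis-feasible b) (basis-⊆ b))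
    (basis-largest b (basis-feasible (basis-isBasis A)) (basis-⊆ (basis-isBasis A)))

  rank-isBasis : ∀ {F A} → IsBasis F A → rank G A ≡ ∣ F ∣
  rank-isBasis {F} {A} b = ℕ.≤-antisym
    (foldr-⊔-≤ (map⁺ (All.map (λ (fH , H⊆A) → p⊆q⇒∣p∣≤∣q∣ (basis-largest b fH H⊆A))
                              (all-feasibleSubsets A))))
    (≤-foldr-⊔ (∈-map⁺ ∣_∣ (∈-feasibleSubsets⁺ (basis-feasible b) (basis-⊆ b))))

  rank-⊤ : rank G ⊤ ≡ n
  rank-⊤ = trans (rank-isBasis ⊤-isBasis) (∣⊤∣≡n n)
    where
    ⊤-isBasis : IsBasis ⊤ ⊤
    ⊤-isBasis = record { basis-feasible = full-feas G ; basis-⊆ = ⊆-refl ; basis-largest = λ _ _ → ⊆⊤ }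

  convexSupersets : Subset n → List (Subset n)
  convexSupersets A = filterᵇ (λ D → convex G D ∧ does (A ⊆? D)) (allSubsets n)

  closure-least : ∀ {A D} → Convex D → A ⊆ D → closure G A ⊆ D
  closure-least {A} {D} cD A⊆D x∈cl =
    All.lookup (foldr-forcesᵇ (λ p q → x∈p∩q⁻ p q) ⊤ (convexSupersets A) x∈cl)
               (∈-filter⁺ (T? ∘ _) (∈-allSubsets D) (T-∧-does (A ⊆? D) .from (cD , A⊆D)))

  ∈-closure : ∀ {A x} → (∀ {D} → Convex D → A ⊆ D → x ∈ D) → x ∈ closure G A
  ∈-closure {A} {x} x∈convex = foldr-preservesᵇ {P = x ∈_} (λ x∈p x∈q → x∈p∩q⁺ (x∈p , x∈q)) ∈⊤
    (All.map (λ t → let cD , A⊆D = T-∧-does (A ⊆? _) .to t in x∈convex cD A⊆D)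
             (all-filter (T? ∘ _) (allSubsets n)))

  ∈-ex⇔ : ∀ {K p} → p ∈ ex G K ⇔ (p ∈ K × p ∉ closure G (K - p))
  ∈-ex⇔ {K} {p} = mk⇔ extreme⇒ ⇒extreme
    where
    cl : Subset n
    cl = closure G (K - p)
    lookup-ex : lookup (ex G K) p ≡ lookup K p ∧ not (lookup cl p)
    lookup-ex = lookup∘tabulate _ p
    extreme⇒ : p ∈ ex G K → p ∈ K × p ∉ cl
    extreme⇒ p∈ex with lookup K p in eK | lookup cl p in eCl | trans (sym lookup-ex) ([]=⇒lookup p∈ex)
    ... | true | false | _ =
      lookup⇒[]= p K eK , λ p∈cl → contradiction (trans (sym eCl) ([]=⇒lookup p∈cl)) λ ()
    ⇒extreme : p ∈ K × p ∉ cl → p ∈ ex G K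
    ⇒extreme (p∈K , p∉cl) with lookup cl p in eCl
    ... | true  = contradiction (lookup⇒[]= p cl eCl) p∉cl
    ... | false = lookup⇒[]= p (ex G K) (trans lookup-ex (cong₂ (λ a b → a ∧ not b) ([]=⇒lookup p∈K) eCl))

  -- If ∁ K ∪ ⁅ p ⁆ were infeasible, every convex D ⊇ K - p would contain p (otherwise
  -- ∁ K ∪ ∁ D = ∁ K ∪ ⁅ p ⁆), putting p in the closure of K - p.
  ex-feasible : ∀ {K p} → Convex K → p ∈ ex G K → Feasible (∁ K ∪ ⁅ p ⁆)
  ex-feasible {K} {p} cK p∈ex with feasible G (∁ K ∪ ⁅ p ⁆) in infeasible
  ... | true  = refl
  ... | false = contradiction (∈-closure p∈convex) (proj₂ (∈-ex⇔ {K} .to p∈ex))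
    where
    p∈convex : ∀ {D} → Convex D → K - p ⊆ D → p ∈ D
    p∈convex {D} cD K-p⊆D with p ∈? D
    ... | yes p∈D = p∈D
    ... | no  p∉D = contradiction (subst Feasible ∁K∪∁D≡∁K∪⁅p⁆ (union-feas G _ _ cK cD))
                                  (λ feasible → contradiction (trans (sym infeasible) feasible) λ ())
      where
      ∁D⊆∁K∪⁅p⁆ : ∁ D ⊆ ∁ K ∪ ⁅ p ⁆
      ∁D⊆∁K∪⁅p⁆ = subst (∁ D ⊆_) (∁-─ K ⁅ p ⁆) (p⊆q⇒∁p⊇∁q K-p⊆D)
      ∁K∪∁D≡∁K∪⁅p⁆ : ∁ K ∪ ∁ D ≡ ∁ K ∪ ⁅ p ⁆
      ∁K∪∁D≡∁K∪⁅p⁆ = p∪q≡p∪r ∁D⊆∁K∪⁅p⁆ (q⊆p∪q (∁ K) (∁ D) ∘ ⁅x⁆⊆p (x∉p⇒x∈∁p p∉D))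

  feasible-ex : ∀ {K p} → p ∈ K → Feasible (∁ K ∪ ⁅ p ⁆) → p ∈ ex G K
  feasible-ex {K} {p} p∈K f = ∈-ex⇔ {K} .from (p∈K , x∉p-x K p ∘ closure-least K-p-convex ⊆-refl)
    where
    K-p-convex : Convex (K - p)
    K-p-convex = subst Feasible (sym (∁-─ K ⁅ p ⁆)) f

  isBasis-∁⇔ : ∀ {K A} → Convex K → IsBasis (∁ K) A ⇔ (∁ K ⊆ A × A ⊆ ∁ K ∪ int G K)
  isBasis-∁⇔ {K} {A} cK = mk⇔ ⇒ ⇐
    where
    ⇒ : IsBasis (∁ K) A → ∁ K ⊆ A × A ⊆ ∁ K ∪ int G K
    ⇒ b = basis-⊆ b , A⊆
      where
      A⊆ : A ⊆ ∁ K ∪ int G K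
      A⊆ {x} x∈A with x ∈? ∁ K
      ... | yes x∈∁K = x∈p∪q⁺ (inj₁ x∈∁K)
      ... | no  x∉∁K with x ∈? ex G K
      ...   | no  x∉ex = x∈p∪q⁺ (inj₂ (x∈p∧x∉q⇒x∈p─q (x∉∁p⇒x∈p x∉∁K) x∉ex))
      ...   | yes x∈ex = contradiction (basis-largest b (ex-feasible cK x∈ex)
                                          (∪-lub (basis-⊆ b) (⁅x⁆⊆p x∈A)) (x∈p∪q⁺ (inj₂ (x∈⁅x⁆ x))))
                                       x∉∁K
    ⇐ : ∁ K ⊆ A × A ⊆ ∁ K ∪ int G K → IsBasis (∁ K) A
    ⇐ (∁K⊆A , A⊆) = record { basis-feasible = cK ; basis-⊆ = ∁K⊆A ; basis-largest = largest }
      where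
      largest : ∀ {H} → Feasible H → H ⊆ A → H ⊆ ∁ K
      largest {H} fH H⊆A with augment cK fH
      ... | inj₁ H⊆∁K = H⊆∁K
      ... | inj₂ (p , p∈H , p∉∁K , f) with x∈p∪q⁻ (∁ K) (int G K) (A⊆ (H⊆A p∈H))
      ...   | inj₁ p∈∁K  = contradiction p∈∁K p∉∁K
      ...   | inj₂ p∈int = contradiction (feasible-ex (x∉∁p⇒x∈p p∉∁K) f) (x∈p─q⇒x∉q K (ex G K) p∈int)

  between? : ∀ K A → Dec (∁ K ⊆ A × A ⊆ ∁ K ∪ int G K)
  between? K A = ∁ K ⊆? A ×-dec A ⊆? ∁ K ∪ int G K

  inInterval : Subset n → Subset n → Bool
  inInterval K A = convex G K ∧ does (between? K A)

  inInterval⇔ : ∀ {K A} → T (inInterval K A) ⇔ K ≡ ∁ (basis A)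
  inInterval⇔ {K} {A} = mk⇔ ⇒ ⇐
    where
    ⇒ : T (inInterval K A) → K ≡ ∁ (basis A)
    ⇒ t with T-∧-does (between? K A) .to t
    ... | cK , bounds =
      trans (sym (∁-involutive K)) (cong ∁ (isBasis-unique (isBasis-∁⇔ cK .from bounds)))
    ⇐ : K ≡ ∁ (basis A) → T (inInterval K A)
    ⇐ refl = T-∧-does (between? K A) .from
               (basis-feasible b , isBasis-∁⇔ (basis-feasible b) .to b)
      where
      b : IsBasis (∁ K) A
      b = subst (λ F → IsBasis F A) (sym (∁-involutive (basis A))) (basis-isBasis A)

  -- The intervals [∁ K, ∁ K ∪ int K] of the convex sets K partition the power set.
  ∑-by-basis : ∀ (h : Subset n → Subset n → ℤ) →
    ∑[ A ← allSubsets n ] h (∁ (basis A)) A ≡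
    ∑[ K ← allSubsets n ] ∑[ A ← allSubsets n ] (if inInterval K A then h K A else 0ℤ)
  ∑-by-basis h =
    trans (∑-cong (allSubsets n) (sym ∘ unique-K)) (∑-comm (allSubsets n) (allSubsets n) _)
    where
    unique-K : ∀ A → ∑[ K ← allSubsets n ] (if inInterval K A then h K A else 0ℤ) ≡ h (∁ (basis A)) A
    unique-K A = trans
      (∑-allSubsets-single _ (∁ (basis A)) λ K K≢ → if-no (T? (inInterval K A)) (K≢ ∘ inInterval⇔ .to))
      (if-yes (T? (inInterval (∁ (basis A)) A)) (inInterval⇔ .from refl))

  convexSum : ℕ → ℕ → ℤ
  convexSum i j =
    ∑[ K ← allSubsets n ] (if convex G K then signedBinom (∣ K ∣) i * δ (∣ int G K ∣) j else 0ℤ)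

  tutte≡convexSum : ∀ i j → tutte G i j ≡ convexSum i j
  tutte≡convexSum i j = begin
    tutte G i j
      ≡⟨ tutte-coeff G i j ⟩
    ∑[ A ← allSubsets n ] signedBinom (rank G ⊤ ∸ rank G A) i * signedBinom (∣ A ∣ ∸ rank G A) j
      ≡⟨ ∑-cong (allSubsets n) (λ A → cong₂ (λ r s → signedBinom r i * signedBinom (∣ A ∣ ∸ s) j)
                                            (corank A) (rank≡ A)) ⟩
    ∑[ A ← allSubsets n ] h (∁ (basis A)) A
      ≡⟨ ∑-by-basis h ⟩
    ∑[ K ← allSubsets n ] ∑[ A ← allSubsets n ] (if inInterval K A then h K A else 0ℤ)
      ≡⟨ ∑-cong (allSubsets n) per-K ⟩
    convexSum i j ∎
    where
    open ≡-Reasoning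
    h : Subset n → Subset n → ℤ
    h K A = signedBinom (∣ K ∣) i * signedBinom (∣ A ∣ ∸ ∣ ∁ K ∣) j
    corank : ∀ A → rank G ⊤ ∸ rank G A ≡ ∣ ∁ (basis A) ∣
    corank A = trans (cong₂ _∸_ rank-⊤ (rank-isBasis (basis-isBasis A))) (sym (∣∁p∣≡n∸∣p∣ (basis A)))
    rank≡ : ∀ A → rank G A ≡ ∣ ∁ (∁ (basis A)) ∣
    rank≡ A = trans (rank-isBasis (basis-isBasis A)) (cong ∣_∣ (sym (∁-involutive (basis A))))
    per-K : ∀ K → ∑[ A ← allSubsets n ] (if inInterval K A then h K A else 0ℤ)
                ≡ (if convex G K then signedBinom (∣ K ∣) i * δ (∣ int G K ∣) j else 0ℤ)
    per-K K with convex G K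
    ... | false = ∑-zero (allSubsets n) λ _ → refl
    ... | true  = begin
      ∑[ A ← allSubsets n ] (if does (between? K A) then h K A else 0ℤ)
        ≡⟨ ∑-cong (allSubsets n) (λ A → *-if (does (between? K A)) (signedBinom (∣ K ∣) i) _) ⟩
      ∑[ A ← allSubsets n ] signedBinom (∣ K ∣) i *
                            (if does (between? K A) then signedBinom (∣ A ∣ ∸ ∣ ∁ K ∣) j else 0ℤ)
        ≡⟨ *-∑ (signedBinom (∣ K ∣) i) (allSubsets n) _ ⟨
      signedBinom (∣ K ∣) i * intervalSum (∁ K) (int G K) (λ k → signedBinom k j)
        ≡⟨ cong (_*_ (signedBinom (∣ K ∣) i))
                (intervalSum-binomialSum (∁ K) (int G K) (∁p∩[p─q]-empty K (ex G K)) _) ⟩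
      signedBinom (∣ K ∣) i * binomialSum (∣ int G K ∣) (λ k → signedBinom k j)
        ≡⟨ cong (_*_ (signedBinom (∣ K ∣) i)) (binomialSum-signedBinom (∣ int G K ∣) j) ⟩
      signedBinom (∣ K ∣) i * δ (∣ int G K ∣) j ∎

  alternating-aCount≡convexSum : ∀ i j →
    ∑[ s ← interval i n ] (-1ℤ ^ (s ∸ i)) * ((+ (s C i)) * (+ aCount G s j)) ≡ convexSum i j
  alternating-aCount≡convexSum i j = begin
    ∑[ s ← interval i n ] (-1ℤ ^ (s ∸ i)) * ((+ (s C i)) * (+ aCount G s j))
      ≡⟨ ∑-cong (interval i n) (λ s → trans (sym (ℤ.*-assoc (-1ℤ ^ (s ∸ i)) _ _))
           (cong (_*_ (signedBinom s i)) (length-filterᵇ (counted s) (allSubsets n)))) ⟩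
    ∑[ s ← interval i n ] signedBinom s i * (∑[ K ← allSubsets n ] indicator (counted s K))
      ≡⟨ ∑-cong (interval i n) (λ s → *-∑ (signedBinom s i) (allSubsets n) _) ⟩
    ∑[ s ← interval i n ] ∑[ K ← allSubsets n ] signedBinom s i * indicator (counted s K)
      ≡⟨ ∑-comm (interval i n) (allSubsets n) _ ⟩
    ∑[ K ← allSubsets n ] ∑[ s ← interval i n ] signedBinom s i * indicator (counted s K)
      ≡⟨ ∑-cong (allSubsets n) per-K ⟩
    convexSum i j ∎
    where
    open ≡-Reasoning
    indicator : Bool → ℤ
    indicator b = if b then 1ℤ else 0ℤ
    counted : ℕ → Subset n → Bool
    counted s K = convex G K ∧ (does (∣ K ∣ ℕ.≟ s) ∧ does (∣ int G K ∣ ℕ.≟ j))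
    per-K : ∀ K →
      ∑[ s ← interval i n ] signedBinom s i *
                            indicator (convex G K ∧ (does (∣ K ∣ ℕ.≟ s) ∧ does (∣ int G K ∣ ℕ.≟ j)))
      ≡ (if convex G K then signedBinom (∣ K ∣) i * indicator (does (∣ int G K ∣ ℕ.≟ j)) else 0ℤ)
    per-K K with convex G K | does (∣ int G K ∣ ℕ.≟ j)
    ... | false | _     = ∑-zero (interval i n) (λ s → ℤ.*-zeroʳ (signedBinom s i))
    ... | true  | false = trans
      (∑-zero (interval i n) λ s →
        trans (cong (λ b → signedBinom s i * indicator b) (∧-zeroʳ (does (∣ K ∣ ℕ.≟ s))))
              (ℤ.*-zeroʳ (signedBinom s i)))
      (sym (ℤ.*-zeroʳ (signedBinom (∣ K ∣) i)))
    ... | true  | true  = trans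
      (∑-cong (interval i n) λ s →
        trans (cong (λ b → signedBinom s i * indicator b) (∧-identityʳ (does (∣ K ∣ ℕ.≟ s))))
              (sym (*-if (does (∣ K ∣ ℕ.≟ s)) (signedBinom s i) 1ℤ)))
      (∑-interval-single (λ s → signedBinom s i * 1ℤ) i n (∣p∣≤n K)
                         (λ K<i → cong (_* 1ℤ) (signedBinom-< K<i)))

lemma4p3 : (n : ℕ) (G : Antimatroid n) (i j : ℕ) →
    tutte G i j ≡ sumℤ (map (λ s → (-1ℤ ^ (s ∸ i)) * ((+ (s C i)) * (+ aCount G s j))) (interval i n))
lemma4p3 n G i j = trans (tutte≡convexSum G i j) (sym (alternating-aCount≡convexSum G i j))
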